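{- Let $P$ be a program over a set of atoms $\mathcal{A}$ and let $x$ be a literal such that, if $x$ occurs in $P$ at all, every occurrence of $x$ in $P$ is under the scope of the symbol $\lnot$. Let $F$ be a formula over a set of atoms $\mathcal{F}$ with $Lit_{\mathcal{F}} \subseteq Lit_{\mathcal{A}}$ and $x \notin Lit_{\mathcal{F}}$. Then $P \cup \{x \leftarrow F\}$ and $P \cup \{x \leftrightarrow F\}$ have exactly the same answer sets.
   Context: Formulas are built from atoms using $\wedge,\vee,\rightarrow,\bot$ and the unary strong negation $\sim$; $\lnot F$ abbreviates $F\rightarrow\bot$, $\top$ abbreviates $\bot\rightarrow\bot$, $F\leftrightarrow G$ abbreviates $(F\rightarrow G)\wedge(G\rightarrow F)$, and $x\leftarrow F$ is the formula $F\rightarrow x$. $\mathrm{N}_2$ is the propositional logic obtained from intuitionistic logic by adding the Nelson strong-negation axioms $\sim(\alpha\rightarrow\beta)\leftrightarrow\alpha\wedge\sim\beta$, $\sim(\alpha\wedge\beta)\leftrightarrow\sim\alpha\vee\sim\beta$, $\sim(\alpha\vee\beta)\leftrightarrow\sim\alpha\wedge\sim\beta$, $\alpha\leftrightarrow\sim\sim\alpha$, $\sim\lnot\alpha\leftrightarrow\alpha$, $\sim a\rightarrow\lnot a$ ($a$ atomic), together with the schema $\alpha\vee(\alpha\rightarrow\beta)\vee\lnot\beta$; $\vdash_{N_2}$ is its derivability. A literal is an atom $a$ or $\sim a$; $Lit_{\mathcal{A}}=\mathcal{A}\cup\{\sim a: a\in\mathcal{A}\}$. A literal $l$ occurs in a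 literal $l$, and occurs in a compound formula iff it occurs in one of its immediate subformulas (so $a$ does not occur in $\sim a$ and vice versa); an occurrence is under the scope of $\lnot$ if it lies inside a subformula of the form $\lnot G$. A program is a finite set of formulas of the form $G\rightarrow l$ with $l$ a literal and $G$ built from literals, $\top,\bot$ by $\wedge,\vee,\lnot$. A set of literals is consistent if it does not contain both $a$ and $\sim a$ for any atom $a$. For a finite set of formulas $T$ over atoms $\mathcal{A}$ and a consistent $M\subseteq Lit_{\mathcal{A}}$, write $\widetilde{M}=Lit_{\mathcal{A}}\setminus M$; $M$ is an answer set of $T$ iff $T\cup\{\lnot l: l\in\widetilde M\}\cup\{\lnot\lnot l: l\in M\}$ is consistent in $\mathrm{N}_2$ and derives in $\mathrm{N}_2$ every literal of $M$. -}

module Defs where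

open import Data.Nat using (ℕ)
open import Data.List using (List; _∷_)
open import Data.List.Membership.Propositional using (_∈_)
open import Data.Product using (_×_; ∃)
open import Data.Empty using (⊥)
open import Data.Sum using (_⊎_)
open import Relation.Nullary using (¬_)
open import Relation.Binary.PropositionalEquality using (_≡_; _≢_)

infixr 4 _⇒_
infixr 5 _∨_
infixr 6 _∧_
infix 7 ∼_
infix 3 _⇔'_
infix 4 _⇐_

data Formula : Set where
  var : ℕ → Formula
  ⊥'  : Formula
  _∧_ : Formula → Formula → Formula
  _∨_ : Formula → Formula → Formula
  _⇒_ : Formula → Formula → Formula
  ∼_  : Formula → Formula

¬' : Formula → Formula
¬' F = F ⇒ ⊥'

⊤' : Formula
⊤' = ⊥' ⇒ ⊥'

_⇔'_ : Formula → Formula → Formula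
F ⇔' G = (F ⇒ G) ∧ (G ⇒ F)

_⇐_ : Formula → Formula → Formula
x ⇐ F = F ⇒ x

data Lit : Set where
  pos : ℕ → Lit
  neg : ℕ → Lit

atomOf : Lit → ℕ
atomOf (pos a) = a
atomOf (neg a) = a

lit : Lit → Formula
lit (pos a) = var a
lit (neg a) = ∼ var a

_∈Lit_ : Lit → List ℕ → Set
l ∈Lit 𝒜 = atomOf l ∈ 𝒜

data NotVar : Formula → Set where
  nv⊥ : NotVar ⊥'
  nv∧ : ∀ {F G} → NotVar (F ∧ G)
  nv∨ : ∀ {F G} → NotVar (F ∨ G)
  nv⇒ : ∀ {F G} → NotVar (F ⇒ G)
  nv∼ : ∀ {F} → NotVar (∼ F)

-- A literal occurs in a formula (a does not occur in ∼a and vice versa).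
data Occurs (x : Lit) : Formula → Set where
  here : ∀ {F} → lit x ≡ F → Occurs x F
  ∧l : ∀ {F G} → Occurs x F → Occurs x (F ∧ G)
  ∧r : ∀ {F G} → Occurs x G → Occurs x (F ∧ G)
  ∨l : ∀ {F G} → Occurs x F → Occurs x (F ∨ G)
  ∨r : ∀ {F G} → Occurs x G → Occurs x (F ∨ G)
  ⇒l : ∀ {F G} → Occurs x F → Occurs x (F ⇒ G)
  ⇒r : ∀ {F G} → Occurs x G → Occurs x (F ⇒ G)
  ∼i : ∀ {F} → NotVar F → Occurs x F → Occurs x (∼ F)

-- An occurrence of x in a formula that does NOT lie inside any subformula of
-- the form ¬G (= G → ⊥).
data OccursUnguarded (x : Lit) : Formula → Set where
  here : ∀ {F} → lit x ≡ F → OccursUnguarded x F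
  ∧l : ∀ {F G} → OccursUnguarded x F → OccursUnguarded x (F ∧ G)
  ∧r : ∀ {F G} → OccursUnguarded x G → OccursUnguarded x (F ∧ G)
  ∨l : ∀ {F G} → OccursUnguarded x F → OccursUnguarded x (F ∨ G)
  ∨r : ∀ {F G} → OccursUnguarded x G → OccursUnguarded x (F ∨ G)
  ⇒l : ∀ {F G} → G ≢ ⊥' → OccursUnguarded x F → OccursUnguarded x (F ⇒ G)
  ⇒r : ∀ {F G} → G ≢ ⊥' → OccursUnguarded x G → OccursUnguarded x (F ⇒ G)
  ∼i : ∀ {F} → NotVar F → OccursUnguarded x F → OccursUnguarded x (∼ F)

FormulaOver : List ℕ → Formula → Set
FormulaOver 𝒜 F = ∀ l → Occurs l F → l ∈Lit 𝒜

data Body : Formula → Set where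
  b-lit : ∀ l → Body (lit l)
  b-⊤ : Body ⊤'
  b-⊥ : Body ⊥'
  b-∧ : ∀ {F G} → Body F → Body G → Body (F ∧ G)
  b-∨ : ∀ {F G} → Body F → Body G → Body (F ∨ G)
  b-¬ : ∀ {F} → Body F → Body (¬' F)

data Rule : Formula → Set where
  rule : ∀ {G} → Body G → (l : Lit) → Rule (G ⇒ lit l)

IsProgram : List Formula → Set
IsProgram P = ∀ {R} → R ∈ P → Rule R

ProgramOver : List ℕ → List Formula → Set
ProgramOver 𝒜 P = IsProgram P × (∀ {R} → R ∈ P → FormulaOver 𝒜 R)

data Axiom : Formula → Set where
  K  : ∀ A B → Axiom (A ⇒ B ⇒ A)
  S  : ∀ A B C → Axiom ((A ⇒ B ⇒ C) ⇒ (A ⇒ B) ⇒ A ⇒ C)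
  ∧E₁ : ∀ A B → Axiom (A ∧ B ⇒ A)
  ∧E₂ : ∀ A B → Axiom (A ∧ B ⇒ B)
  ∧I : ∀ A B → Axiom (A ⇒ B ⇒ A ∧ B)
  ∨I₁ : ∀ A B → Axiom (A ⇒ A ∨ B)
  ∨I₂ : ∀ A B → Axiom (B ⇒ A ∨ B)
  ∨E : ∀ A B C → Axiom ((A ⇒ C) ⇒ (B ⇒ C) ⇒ A ∨ B ⇒ C)
  ⊥E : ∀ A → Axiom (⊥' ⇒ A)
  N⇒ : ∀ A B → Axiom (∼ (A ⇒ B) ⇔' A ∧ ∼ B)
  N∧ : ∀ A B → Axiom (∼ (A ∧ B) ⇔' ∼ A ∨ ∼ B)
  N∨ : ∀ A B → Axiom (∼ (A ∨ B) ⇔' ∼ A ∧ ∼ B)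
  N∼ : ∀ A → Axiom (A ⇔' ∼ ∼ A)
  N¬ : ∀ A → Axiom (∼ ¬' A ⇔' A)
  Natom : ∀ a → Axiom (∼ var a ⇒ ¬' (var a))
  N2 : ∀ A B → Axiom (A ∨ (A ⇒ B) ∨ ¬' B)

data _⊢_ (Γ : Formula → Set) : Formula → Set where
  hyp : ∀ {F} → Γ F → Γ ⊢ F
  ax  : ∀ {F} → Axiom F → Γ ⊢ F
  mp  : ∀ {F G} → Γ ⊢ (F ⇒ G) → Γ ⊢ F → Γ ⊢ G

-- Sets of literals are lists, used only through membership.
ConsistentLits : List Lit → Set
ConsistentLits M = ∀ a → pos a ∈ M → neg a ∈ M → ⊥

data Completion (𝒜 : List ℕ) (T : Formula → Set) (M : List Lit) : Formula → Set where
  inT : ∀ {F} → T F → Completion 𝒜 T M F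
  inM̃ : ∀ l → l ∈Lit 𝒜 → ¬ (l ∈ M) → Completion 𝒜 T M (¬' (lit l))
  inM : ∀ l → l ∈ M → Completion 𝒜 T M (¬' (¬' (lit l)))

AnswerSet : List ℕ → (Formula → Set) → List Lit → Set
AnswerSet 𝒜 T M =
  (∀ {l} → l ∈ M → l ∈Lit 𝒜) ×
  ConsistentLits M ×
  ¬ (Completion 𝒜 T M ⊢ ⊥') ×
  (∀ l → l ∈ M → Completion 𝒜 T M ⊢ lit l)

_∪｛_｝ : List Formula → Formula → Formula → Set
(P ∪｛ G ｝) F = F ∈ P ⊎ F ≡ G

{-# OPTIONS --safe #-}
module Submission where

-- N₂ is sound for here-and-there valuations with strong negation, which give every literal
-- one of the values 𝟘 < ½ < 𝟙.  Conversely, a Kalmár-style argument, with N₂'s axiom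
-- splitting every literal of M into "true" or "equivalent to the goal", shows that M is an
-- answer set of a finite theory T exactly when ⟨M, M⟩ is an equilibrium model of T: a model
-- of T such that every model with the same there-part is total on M.
--
-- Every model of x ↔ F is a model of F → x, and a model v of P ∪ {F → x} becomes a model
-- of P ∪ {x ↔ F} by resetting x to the value of F: this changes neither F, in which x does
-- not occur, nor the rules of P, which see x only under ¬ and ¬ only sees the there-part.
-- Finally ⟨M, M⟩ satisfies x ↔ F: otherwise x ∈ M while F is false, and lowering x to ½
-- would give a model with the same there-part that is not total on M.

open import Defs
open import Data.Nat using (ℕ; _≟_)
open import Data.List using (List; []; _∷_; map)
open import Data.List.Membership.Propositional using (_∈_; _∉_; find)
open import Data.List.Membership.Propositional.Properties using (∈-map⁺; ∈-map⁻)
open import Data.List.Relation.Unary.Any using (here; there)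
open import Data.List.Relation.Unary.All as All using (all?)
open import Data.List.Relation.Unary.All.Properties using (¬All⇒Any¬)
open import Data.List.Relation.Binary.Sublist.Propositional using (_⊆_; lookup)
open import Data.List.Relation.Binary.Sublist.Heterogeneous using ([]; _∷_; _∷ʳ_)
open import Data.Product using (_×_; _,_)
open import Data.Product.Function.NonDependent.Propositional using (_×-⇔_)
open import Data.Sum using (_⊎_; inj₁; inj₂)
open import Function using (_∘_)
open import Function.Bundles using (_⇔_; mk⇔; Equivalence)
import Function.Properties.Equivalence as ⇔
open import Relation.Nullary using (¬_; Dec; yes; no; contradiction)
open import Relation.Nullary.Decidable using (True; toWitness; map′)
open import Relation.Binary.Definitions using (DecidableEquality)
open import Relation.Binary.PropositionalEquality
  using (_≡_; _≢_; refl; sym; trans; cong; cong₂; subst; _≗_; module ≡-Reasoning)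

open Equivalence using (to; from)
open ≡-Reasoning

data HT : Set where
  𝟘 ½ 𝟙 : HT

infixr 7 _⊓_
infixr 6 _⊔_
infixr 5 _⇛_

_⊓_ : HT → HT → HT
𝟘 ⊓ _ = 𝟘
½ ⊓ 𝟘 = 𝟘
½ ⊓ _ = ½
𝟙 ⊓ b = b

_⊔_ : HT → HT → HT
𝟘 ⊔ b = b
½ ⊔ 𝟙 = 𝟙
½ ⊔ _ = ½
𝟙 ⊔ _ = 𝟙

_⇛_ : HT → HT → HT
𝟘 ⇛ _ = 𝟙
½ ⇛ 𝟘 = 𝟘
½ ⇛ _ = 𝟙
𝟙 ⇛ b = b

-- The truth value in the there-world.
⌈_⌉ : HT → HT
⌈ 𝟘 ⌉ = 𝟘
⌈ _ ⌉ = 𝟙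

_≟ₕ_ : DecidableEquality HT
𝟘 ≟ₕ 𝟘 = yes refl
½ ≟ₕ ½ = yes refl
𝟙 ≟ₕ 𝟙 = yes refl
𝟘 ≟ₕ ½ = no λ ()
𝟘 ≟ₕ 𝟙 = no λ ()
½ ≟ₕ 𝟘 = no λ ()
½ ≟ₕ 𝟙 = no λ ()
𝟙 ≟ₕ 𝟘 = no λ ()
𝟙 ≟ₕ ½ = no λ ()

record Everywhere (P : HT → Set) : Set where
  field
    at𝟘 : P 𝟘
    at½ : P ½
    at𝟙 : P 𝟙

everywhere : ∀ {P} → Everywhere P → ∀ a → P a
everywhere t 𝟘 = Everywhere.at𝟘 t
everywhere t ½ = Everywhere.at½ t
everywhere t 𝟙 = Everywhere.at𝟙 t

-- The table argument is always given as _: it normalises to nested records of ⊤,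
-- which Agda fills in by η.
by-table₁ : (f g : HT → HT) → Everywhere (λ a → True (f a ≟ₕ g a)) → ∀ a → f a ≡ g a
by-table₁ f g t a = toWitness (everywhere t a)

by-table₂ : (f g : HT → HT → HT) →
  Everywhere (λ a → Everywhere λ b → True (f a b ≟ₕ g a b)) → ∀ a b → f a b ≡ g a b
by-table₂ f g t a b = toWitness (everywhere (everywhere t a) b)

by-table₃ : (f g : HT → HT → HT → HT) →
  Everywhere (λ a → Everywhere λ b → Everywhere λ c → True (f a b c ≟ₕ g a b c)) →
  ∀ a b c → f a b c ≡ g a b c
by-table₃ f g t a b c = toWitness (everywhere (everywhere (everywhere t a) b) c)

valid₁ : (f : HT → HT) → Everywhere (λ a → True (f a ≟ₕ 𝟙)) → ∀ a → f a ≡ 𝟙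
valid₁ f = by-table₁ f (λ _ → 𝟙)

valid₂ : (f : HT → HT → HT) →
  Everywhere (λ a → Everywhere λ b → True (f a b ≟ₕ 𝟙)) → ∀ a b → f a b ≡ 𝟙
valid₂ f = by-table₂ f (λ _ _ → 𝟙)

valid₃ : (f : HT → HT → HT → HT) →
  Everywhere (λ a → Everywhere λ b → Everywhere λ c → True (f a b c ≟ₕ 𝟙)) →
  ∀ a b c → f a b c ≡ 𝟙
valid₃ f = by-table₃ f (λ _ _ _ → 𝟙)

⇛-mp : ∀ {a b} → a ⇛ b ≡ 𝟙 → a ≡ 𝟙 → b ≡ 𝟙
⇛-mp a⇛b refl = a⇛b

⇛𝟙-𝟘 : ∀ a {b} → a ⇛ b ≡ 𝟙 → b ≡ 𝟘 → a ≡ 𝟘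
⇛𝟙-𝟘 𝟘 _ _ = refl
⇛𝟙-𝟘 ½ () refl
⇛𝟙-𝟘 𝟙 () refl

⊓-𝟙ʳ : ∀ a b → a ⊓ b ≡ 𝟙 → b ≡ 𝟙
⊓-𝟙ʳ 𝟙 _ b≡𝟙 = b≡𝟙
⊓-𝟙ʳ 𝟘 _ ()
⊓-𝟙ʳ ½ 𝟘 ()
⊓-𝟙ʳ ½ ½ ()
⊓-𝟙ʳ ½ 𝟙 ()

⇔-𝟙 : ∀ {a b} → a ≡ b → (a ⇛ b) ⊓ (b ⇛ a) ≡ 𝟙
⇔-𝟙 {a} refl = valid₁ (λ a → (a ⇛ a) ⊓ (a ⇛ a)) _ a

𝟙-⇔ : ∀ a b → (a ⇛ b) ⊓ (b ⇛ a) ≡ 𝟙 → a ≡ b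
𝟙-⇔ 𝟘 𝟘 _ = refl
𝟙-⇔ ½ ½ _ = refl
𝟙-⇔ 𝟙 𝟙 _ = refl
𝟙-⇔ 𝟘 ½ ()
𝟙-⇔ 𝟘 𝟙 ()
𝟙-⇔ ½ 𝟘 ()
𝟙-⇔ ½ 𝟙 ()
𝟙-⇔ 𝟙 𝟘 ()
𝟙-⇔ 𝟙 ½ ()

⌈⌉-𝟘 : ∀ a → ⌈ a ⌉ ≡ 𝟘 → a ≡ 𝟘
⌈⌉-𝟘 𝟘 _ = refl
⌈⌉-𝟘 ½ ()
⌈⌉-𝟘 𝟙 ()

⌈⌉-fixed : ∀ a → a ≡ ⌈ a ⌉ → a ≢ 𝟘 → a ≡ 𝟙
⌈⌉-fixed 𝟘 _ a≢𝟘 = contradiction refl a≢𝟘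
⌈⌉-fixed ½ ()
⌈⌉-fixed 𝟙 _ _ = refl

⌈⌉-⊓ : ∀ a b → ⌈ a ⊓ b ⌉ ≡ ⌈ a ⌉ ⊓ ⌈ b ⌉
⌈⌉-⊓ = by-table₂ (λ a b → ⌈ a ⊓ b ⌉) (λ a b → ⌈ a ⌉ ⊓ ⌈ b ⌉) _

⌈⌉-⊔ : ∀ a b → ⌈ a ⊔ b ⌉ ≡ ⌈ a ⌉ ⊔ ⌈ b ⌉
⌈⌉-⊔ = by-table₂ (λ a b → ⌈ a ⊔ b ⌉) (λ a b → ⌈ a ⌉ ⊔ ⌈ b ⌉) _

⌈⌉-⇛ : ∀ a b → ⌈ a ⇛ b ⌉ ≡ ⌈ a ⌉ ⇛ ⌈ b ⌉
⌈⌉-⇛ = by-table₂ (λ a b → ⌈ a ⇛ b ⌉) (λ a b → ⌈ a ⌉ ⇛ ⌈ b ⌉) _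

¬-⌈⌉ : ∀ a → a ⇛ 𝟘 ≡ ⌈ a ⌉ ⇛ 𝟘
¬-⌈⌉ = by-table₁ (λ a → a ⇛ 𝟘) (λ a → ⌈ a ⌉ ⇛ 𝟘) _

¬¬-⌈⌉ : ∀ a → (a ⇛ 𝟘) ⇛ 𝟘 ≡ ⌈ a ⌉
¬¬-⌈⌉ = by-table₁ (λ a → (a ⇛ 𝟘) ⇛ 𝟘) ⌈_⌉ _

Valuation : Set
Valuation = Lit → HT

private
  variable
    A B G R X Y : Formula
    Ψ P Ts : List Formula
    Γ Δ T : Formula → Set
    𝒜 ℬ : List ℕ
    H L M : List Lit
    l x : Lit
    v w : Valuation

mutual
  ⟦_⟧ : Formula → Valuation → HT
  ⟦ var a ⟧ v = v (pos a)
  ⟦ ⊥' ⟧ v = 𝟘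
  ⟦ A ∧ B ⟧ v = ⟦ A ⟧ v ⊓ ⟦ B ⟧ v
  ⟦ A ∨ B ⟧ v = ⟦ A ⟧ v ⊔ ⟦ B ⟧ v
  ⟦ A ⇒ B ⟧ v = ⟦ A ⟧ v ⇛ ⟦ B ⟧ v
  ⟦ ∼ A ⟧ v = ⟦∼ A ⟧ v

  ⟦∼_⟧ : Formula → Valuation → HT
  ⟦∼ var a ⟧ v = v (neg a)
  ⟦∼ ⊥' ⟧ v = 𝟙
  ⟦∼ A ∧ B ⟧ v = ⟦∼ A ⟧ v ⊔ ⟦∼ B ⟧ v
  ⟦∼ A ∨ B ⟧ v = ⟦∼ A ⟧ v ⊓ ⟦∼ B ⟧ v
  ⟦∼ A ⇒ B ⟧ v = ⟦ A ⟧ v ⊓ ⟦∼ B ⟧ v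
  ⟦∼ ∼ A ⟧ v = ⟦ A ⟧ v

infix 4 _⊨_
_⊨_ : Valuation → (Formula → Set) → Set
v ⊨ T = ∀ {R} → T R → ⟦ R ⟧ v ≡ 𝟙

⟦lit⟧ : ∀ l → ⟦ lit l ⟧ v ≡ v l
⟦lit⟧ (pos _) = refl
⟦lit⟧ (neg _) = refl

⟦lit⟧-cong : ∀ l → v l ≡ w l → ⟦ lit l ⟧ v ≡ ⟦ lit l ⟧ w
⟦lit⟧-cong (pos _) eq = eq
⟦lit⟧-cong (neg _) eq = eq

mutual
  ⟦⟧-⌈⌉ : (∀ l → w l ≡ ⌈ v l ⌉) → ∀ G → ⟦ G ⟧ w ≡ ⌈ ⟦ G ⟧ v ⌉
  ⟦⟧-⌈⌉ w≗ (var a) = w≗ (pos a)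
  ⟦⟧-⌈⌉ w≗ ⊥' = refl
  ⟦⟧-⌈⌉ {v = v} w≗ (A ∧ B) =
    trans (cong₂ _⊓_ (⟦⟧-⌈⌉ w≗ A) (⟦⟧-⌈⌉ w≗ B)) (sym (⌈⌉-⊓ (⟦ A ⟧ v) (⟦ B ⟧ v)))
  ⟦⟧-⌈⌉ {v = v} w≗ (A ∨ B) =
    trans (cong₂ _⊔_ (⟦⟧-⌈⌉ w≗ A) (⟦⟧-⌈⌉ w≗ B)) (sym (⌈⌉-⊔ (⟦ A ⟧ v) (⟦ B ⟧ v)))
  ⟦⟧-⌈⌉ {v = v} w≗ (A ⇒ B) =
    trans (cong₂ _⇛_ (⟦⟧-⌈⌉ w≗ A) (⟦⟧-⌈⌉ w≗ B)) (sym (⌈⌉-⇛ (⟦ A ⟧ v) (⟦ B ⟧ v)))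
  ⟦⟧-⌈⌉ w≗ (∼ A) = ⟦∼⟧-⌈⌉ w≗ A

  ⟦∼⟧-⌈⌉ : (∀ l → w l ≡ ⌈ v l ⌉) → ∀ G → ⟦∼ G ⟧ w ≡ ⌈ ⟦∼ G ⟧ v ⌉
  ⟦∼⟧-⌈⌉ w≗ (var a) = w≗ (neg a)
  ⟦∼⟧-⌈⌉ w≗ ⊥' = refl
  ⟦∼⟧-⌈⌉ {v = v} w≗ (A ∧ B) =
    trans (cong₂ _⊔_ (⟦∼⟧-⌈⌉ w≗ A) (⟦∼⟧-⌈⌉ w≗ B)) (sym (⌈⌉-⊔ (⟦∼ A ⟧ v) (⟦∼ B ⟧ v)))
  ⟦∼⟧-⌈⌉ {v = v} w≗ (A ∨ B) =
    trans (cong₂ _⊓_ (⟦∼⟧-⌈⌉ w≗ A) (⟦∼⟧-⌈⌉ w≗ B)) (sym (⌈⌉-⊓ (⟦∼ A ⟧ v) (⟦∼ B ⟧ v)))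
  ⟦∼⟧-⌈⌉ {v = v} w≗ (A ⇒ B) =
    trans (cong₂ _⊓_ (⟦⟧-⌈⌉ w≗ A) (⟦∼⟧-⌈⌉ w≗ B)) (sym (⌈⌉-⊓ (⟦ A ⟧ v) (⟦∼ B ⟧ v)))
  ⟦∼⟧-⌈⌉ w≗ (∼ A) = ⟦⟧-⌈⌉ w≗ A

⌈⟦⟧⌉-cong : ⌈_⌉ ∘ v ≗ ⌈_⌉ ∘ w → ∀ G → ⌈ ⟦ G ⟧ v ⌉ ≡ ⌈ ⟦ G ⟧ w ⌉
⌈⟦⟧⌉-cong same-there G = trans (sym (⟦⟧-⌈⌉ (λ _ → refl) G)) (⟦⟧-⌈⌉ same-there G)

restrict : (∀ {l} → Occurs l G → Occurs l B) → FormulaOver 𝒜 B → FormulaOver 𝒜 G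
restrict sub over l = over l ∘ sub

over-∼ : ∀ G → FormulaOver 𝒜 (∼ G) → FormulaOver 𝒜 G
over-∼ (var a) over (pos _) (here refl) = over (neg a) (here refl)
over-∼ (var a) over (neg _) (here ())
over-∼ ⊥' over = restrict (∼i nv⊥) over
over-∼ (A ∧ B) over = restrict (∼i nv∧) over
over-∼ (A ∨ B) over = restrict (∼i nv∨) over
over-∼ (A ⇒ B) over = restrict (∼i nv⇒) over
over-∼ (∼ A) over = restrict (∼i nv∼) over

over-mono : (∀ l → l ∈Lit 𝒜 → l ∈Lit ℬ) → FormulaOver 𝒜 G → FormulaOver ℬ G
over-mono 𝒜⊆ℬ over l = 𝒜⊆ℬ l ∘ over l

over-∧ : FormulaOver 𝒜 A → FormulaOver 𝒜 B → FormulaOver 𝒜 (A ∧ B)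
over-∧ _ _ (pos _) (here ())
over-∧ _ _ (neg _) (here ())
over-∧ overA _ l (∧l o) = overA l o
over-∧ _ overB l (∧r o) = overB l o

over-⇒ : FormulaOver 𝒜 A → FormulaOver 𝒜 B → FormulaOver 𝒜 (A ⇒ B)
over-⇒ _ _ (pos _) (here ())
over-⇒ _ _ (neg _) (here ())
over-⇒ overA _ l (⇒l o) = overA l o
over-⇒ _ overB l (⇒r o) = overB l o

occurs-lit : ∀ {l m} → Occurs l (lit m) → l ≡ m
occurs-lit {pos _} {pos _} (here refl) = refl
occurs-lit {neg _} {neg _} (here refl) = refl
occurs-lit {pos _} {neg _} (here ())
occurs-lit {neg _} {pos _} (here ())
occurs-lit {m = neg _} (∼i () _)

over-lit : FormulaOver (atomOf x ∷ 𝒜) (lit x)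
over-lit l o = here (cong atomOf (occurs-lit o))

module _ {v w : Valuation} (agree : ∀ l → l ∈Lit 𝒜 → v l ≡ w l) where
  mutual
    ⟦⟧-coincide : ∀ G → FormulaOver 𝒜 G → ⟦ G ⟧ v ≡ ⟦ G ⟧ w
    ⟦⟧-coincide (var a) over = agree (pos a) (over (pos a) (here refl))
    ⟦⟧-coincide ⊥' _ = refl
    ⟦⟧-coincide (A ∧ B) over =
      cong₂ _⊓_ (⟦⟧-coincide A (restrict ∧l over)) (⟦⟧-coincide B (restrict ∧r over))
    ⟦⟧-coincide (A ∨ B) over =
      cong₂ _⊔_ (⟦⟧-coincide A (restrict ∨l over)) (⟦⟧-coincide B (restrict ∨r over))
    ⟦⟧-coincide (A ⇒ B) over =
      cong₂ _⇛_ (⟦⟧-coincide A (restrict ⇒l over)) (⟦⟧-coincide B (restrict ⇒r over))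
    ⟦⟧-coincide (∼ A) over = ⟦∼⟧-coincide A (over-∼ A over)

    ⟦∼⟧-coincide : ∀ G → FormulaOver 𝒜 G → ⟦∼ G ⟧ v ≡ ⟦∼ G ⟧ w
    ⟦∼⟧-coincide (var a) over = agree (neg a) (over (pos a) (here refl))
    ⟦∼⟧-coincide ⊥' _ = refl
    ⟦∼⟧-coincide (A ∧ B) over =
      cong₂ _⊔_ (⟦∼⟧-coincide A (restrict ∧l over)) (⟦∼⟧-coincide B (restrict ∧r over))
    ⟦∼⟧-coincide (A ∨ B) over =
      cong₂ _⊓_ (⟦∼⟧-coincide A (restrict ∨l over)) (⟦∼⟧-coincide B (restrict ∨r over))
    ⟦∼⟧-coincide (A ⇒ B) over =
      cong₂ _⊓_ (⟦⟧-coincide A (restrict ⇒l over)) (⟦∼⟧-coincide B (restrict ⇒r over))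
    ⟦∼⟧-coincide (∼ A) over = ⟦⟧-coincide A (over-∼ A over)

lit≢⊥ : ∀ l → lit l ≢ ⊥'
lit≢⊥ (pos _) ()
lit≢⊥ (neg _) ()

module _ {v w : Valuation} (agree : ∀ l → l ≢ x → v l ≡ w l)
         (same-there : ⌈_⌉ ∘ v ≗ ⌈_⌉ ∘ w) where
  body-invariant : Body G → ¬ OccursUnguarded x G → ⟦ G ⟧ v ≡ ⟦ G ⟧ w
  body-invariant (b-lit l) x∉ =
    ⟦lit⟧-cong l (agree l λ l≡x → x∉ (here (cong lit (sym l≡x))))
  body-invariant b-⊤ _ = refl
  body-invariant b-⊥ _ = refl
  body-invariant (b-∧ p q) x∉ =
    cong₂ _⊓_ (body-invariant p (x∉ ∘ ∧l)) (body-invariant q (x∉ ∘ ∧r))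
  body-invariant (b-∨ p q) x∉ =
    cong₂ _⊔_ (body-invariant p (x∉ ∘ ∨l)) (body-invariant q (x∉ ∘ ∨r))
  -- x may occur in G, but ¬G only depends on the there-part of G's value.
  body-invariant (b-¬ {G} _) _ = begin
    ⟦ G ⟧ v ⇛ 𝟘       ≡⟨ ¬-⌈⌉ (⟦ G ⟧ v) ⟩
    ⌈ ⟦ G ⟧ v ⌉ ⇛ 𝟘   ≡⟨ cong (_⇛ 𝟘) (⌈⟦⟧⌉-cong same-there G) ⟩
    ⌈ ⟦ G ⟧ w ⌉ ⇛ 𝟘   ≡⟨ sym (¬-⌈⌉ (⟦ G ⟧ w)) ⟩
    ⟦ G ⟧ w ⇛ 𝟘       ∎

  rule-invariant : Rule R → ¬ OccursUnguarded x R → ⟦ R ⟧ v ≡ ⟦ R ⟧ w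
  rule-invariant (rule body l) x∉ = cong₂ _⇛_
    (body-invariant body (x∉ ∘ ⇒l (lit≢⊥ l)))
    (⟦lit⟧-cong l (agree l λ l≡x → x∉ (⇒r (lit≢⊥ l) (here (cong lit (sym l≡x))))))

_≟ˡ_ : DecidableEquality Lit
pos a ≟ˡ pos b = map′ (cong pos) (λ { refl → refl }) (a ≟ b)
neg a ≟ˡ neg b = map′ (cong neg) (λ { refl → refl }) (a ≟ b)
pos _ ≟ˡ neg _ = no λ ()
neg _ ≟ˡ pos _ = no λ ()

open import Data.List.Membership.DecPropositional _≟ˡ_ using (_∈?_)

_[_≔_] : Valuation → Lit → HT → Valuation
(v [ x ≔ e ]) l with l ≟ˡ x
... | yes _ = e
... | no _ = v l

[≔]-at : ∀ v x e → (v [ x ≔ e ]) x ≡ e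
[≔]-at v x e with x ≟ˡ x
... | yes _ = refl
... | no x≢x = contradiction refl x≢x

[≔]-off : ∀ v e → l ≢ x → (v [ x ≔ e ]) l ≡ v l
[≔]-off {l} {x} v e l≢x with l ≟ˡ x
... | yes l≡x = contradiction l≡x l≢x
... | no _ = refl

[≔]-⌈⌉ : ∀ v x e → ⌈ e ⌉ ≡ ⌈ v x ⌉ → ⌈_⌉ ∘ (v [ x ≔ e ]) ≗ ⌈_⌉ ∘ v
[≔]-⌈⌉ v x e same l with l ≟ˡ x
... | yes refl = same
... | no _ = refl

-- The here-and-there interpretation ⟨H, T⟩, meant for H ⊆ T.
⟨_,_⟩ : List Lit → List Lit → Valuation
⟨ H , T ⟩ l with l ∈? H | l ∈? T
... | yes _ | _ = 𝟙
... | no _ | yes _ = ½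
... | no _ | no _ = 𝟘

⟨⟩-𝟙 : l ∈ H → ⟨ H , M ⟩ l ≡ 𝟙
⟨⟩-𝟙 {l} {H} {M} l∈H with l ∈? H | l ∈? M
... | yes _ | _ = refl
... | no l∉H | _ = contradiction l∈H l∉H

⟨⟩-𝟘 : l ∉ H → l ∉ M → ⟨ H , M ⟩ l ≡ 𝟘
⟨⟩-𝟘 {l} {H} {M} l∉H l∉M with l ∈? H | l ∈? M
... | yes l∈H | _ = contradiction l∈H l∉H
... | no _ | yes l∈M = contradiction l∈M l∉M
... | no _ | no _ = refl

⟨⟩-⌈⌉ : (∀ {l} → l ∈ H → l ∈ M) → ⌈_⌉ ∘ ⟨ H , M ⟩ ≗ ⟨ M , M ⟩
⟨⟩-⌈⌉ {H} {M} H⊆M l with l ∈? H | l ∈? M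
... | yes _ | yes _ = refl
... | yes l∈H | no l∉M = contradiction (H⊆M l∈H) l∉M
... | no _ | yes _ = refl
... | no _ | no _ = refl

⟨M,M⟩-⌈⌉ : ⌈_⌉ ∘ ⟨ M , M ⟩ ≗ ⟨ M , M ⟩
⟨M,M⟩-⌈⌉ = ⟨⟩-⌈⌉ λ l∈M → l∈M

⟨M,M⟩-two-valued : ∀ G → ⟦ G ⟧ ⟨ M , M ⟩ ≡ ⌈ ⟦ G ⟧ ⟨ M , M ⟩ ⌉
⟨M,M⟩-two-valued = ⟦⟧-⌈⌉ (sym ∘ ⟨M,M⟩-⌈⌉)

Consistent : Valuation → Set
Consistent v = ∀ a → v (pos a) ≡ 𝟘 ⊎ v (neg a) ≡ 𝟘

module _ {v : Valuation} (consistent : Consistent v) where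
  axiom-valid : Axiom G → ⟦ G ⟧ v ≡ 𝟙
  axiom-valid (K A B) = valid₂ (λ a b → a ⇛ b ⇛ a) _ (⟦ A ⟧ v) (⟦ B ⟧ v)
  axiom-valid (S A B C) =
    valid₃ (λ a b c → (a ⇛ b ⇛ c) ⇛ (a ⇛ b) ⇛ a ⇛ c) _ (⟦ A ⟧ v) (⟦ B ⟧ v) (⟦ C ⟧ v)
  axiom-valid (∧E₁ A B) = valid₂ (λ a b → a ⊓ b ⇛ a) _ (⟦ A ⟧ v) (⟦ B ⟧ v)
  axiom-valid (∧E₂ A B) = valid₂ (λ a b → a ⊓ b ⇛ b) _ (⟦ A ⟧ v) (⟦ B ⟧ v)
  axiom-valid (∧I A B) = valid₂ (λ a b → a ⇛ b ⇛ a ⊓ b) _ (⟦ A ⟧ v) (⟦ B ⟧ v)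
  axiom-valid (∨I₁ A B) = valid₂ (λ a b → a ⇛ a ⊔ b) _ (⟦ A ⟧ v) (⟦ B ⟧ v)
  axiom-valid (∨I₂ A B) = valid₂ (λ a b → b ⇛ a ⊔ b) _ (⟦ A ⟧ v) (⟦ B ⟧ v)
  axiom-valid (∨E A B C) =
    valid₃ (λ a b c → (a ⇛ c) ⇛ (b ⇛ c) ⇛ a ⊔ b ⇛ c) _ (⟦ A ⟧ v) (⟦ B ⟧ v) (⟦ C ⟧ v)
  axiom-valid (⊥E A) = refl
  axiom-valid (N⇒ A B) = ⇔-𝟙 {⟦ A ⟧ v ⊓ ⟦∼ B ⟧ v} refl
  axiom-valid (N∧ A B) = ⇔-𝟙 {⟦∼ A ⟧ v ⊔ ⟦∼ B ⟧ v} refl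
  axiom-valid (N∨ A B) = ⇔-𝟙 {⟦∼ A ⟧ v ⊓ ⟦∼ B ⟧ v} refl
  axiom-valid (N∼ A) = ⇔-𝟙 {⟦ A ⟧ v} refl
  axiom-valid (N¬ A) = valid₁ (λ a → (a ⊓ 𝟙 ⇛ a) ⊓ (a ⇛ a ⊓ 𝟙)) _ (⟦ A ⟧ v)
  axiom-valid (Natom a) with consistent a
  ... | inj₁ pos≡𝟘 rewrite pos≡𝟘 = valid₁ (_⇛ 𝟙) _ (v (neg a))
  ... | inj₂ neg≡𝟘 rewrite neg≡𝟘 = refl
  axiom-valid (N2 A B) = valid₂ (λ a b → a ⊔ (a ⇛ b) ⊔ (b ⇛ 𝟘)) _ (⟦ A ⟧ v) (⟦ B ⟧ v)

  sound : v ⊨ Γ → Γ ⊢ G → ⟦ G ⟧ v ≡ 𝟙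
  sound v⊨Γ (hyp g) = v⊨Γ g
  sound v⊨Γ (ax α) = axiom-valid α
  sound v⊨Γ (mp d e) = ⇛-mp (sound v⊨Γ d) (sound v⊨Γ e)

module _ {M : List Lit} {v : Valuation} (shaped : ⌈_⌉ ∘ v ≗ ⟨ M , M ⟩) where
  shaped-∉ : l ∉ M → v l ≡ 𝟘
  shaped-∉ {l} l∉M = ⌈⌉-𝟘 (v l) (trans (shaped l) (⟨⟩-𝟘 l∉M l∉M))

  shaped-∈ : l ∈ M → ⌈ v l ⌉ ≡ 𝟙
  shaped-∈ {l} l∈M = trans (shaped l) (⟨⟩-𝟙 l∈M)

  shaped-consistent : ConsistentLits M → Consistent v
  shaped-consistent cons a with pos a ∈? M
  ... | no pos∉M = inj₁ (shaped-∉ pos∉M)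
  ... | yes pos∈M = inj₂ (shaped-∉ (cons a pos∈M))

  completion-sound : ConsistentLits M → v ⊨ T → Completion 𝒜 T M ⊢ G → ⟦ G ⟧ v ≡ 𝟙
  completion-sound {T} {𝒜} cons v⊨T = sound (shaped-consistent cons) v⊨completion
    where
    v⊨completion : v ⊨ Completion 𝒜 T M
    v⊨completion (inT t) = v⊨T t
    v⊨completion (inM̃ l _ l∉M) = cong (_⇛ 𝟘) (trans (⟦lit⟧ l) (shaped-∉ l∉M))
    v⊨completion (inM l l∈M) =
      trans (¬¬-⌈⌉ (⟦ lit l ⟧ v)) (trans (cong ⌈_⌉ (⟦lit⟧ l)) (shaped-∈ l∈M))

infixl 5 _▸_
_▸_ : (Formula → Set) → Formula → Formula → Set
(Γ ▸ A) F = Γ F ⊎ F ≡ A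

weaken : (∀ {F} → Γ F → Δ F) → Γ ⊢ G → Δ ⊢ G
weaken Γ⊆Δ (hyp g) = hyp (Γ⊆Δ g)
weaken Γ⊆Δ (ax α) = ax α
weaken Γ⊆Δ (mp d e) = mp (weaken Γ⊆Δ d) (weaken Γ⊆Δ e)

infixl 6 _·_
_·_ : Γ ⊢ (A ⇒ B) → Γ ⊢ A → Γ ⊢ B
_·_ = mp

⊢-id : Γ ⊢ (A ⇒ A)
⊢-id {A = A} = ax (S A (A ⇒ A) A) · ax (K A (A ⇒ A)) · ax (K A A)

infixr 4 ƛ_
ƛ_ : (Γ ▸ A) ⊢ B → Γ ⊢ (A ⇒ B)
ƛ hyp (inj₁ g) = ax (K _ _) · hyp g
ƛ hyp (inj₂ refl) = ⊢-id
ƛ ax α = ax (K _ _) · ax α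
ƛ mp d e = ax (S _ _ _) · (ƛ d) · (ƛ e)

top : (Γ ▸ A) ⊢ A
top = hyp (inj₂ refl)

wk : Γ ⊢ G → (Γ ▸ A) ⊢ G
wk = weaken inj₁

pair : Γ ⊢ A → Γ ⊢ B → Γ ⊢ (A ∧ B)
pair d e = ax (∧I _ _) · d · e

fst : Γ ⊢ (A ∧ B) → Γ ⊢ A
fst d = ax (∧E₁ _ _) · d

snd : Γ ⊢ (A ∧ B) → Γ ⊢ B
snd d = ax (∧E₂ _ _) · d

inl : Γ ⊢ A → Γ ⊢ (A ∨ B)
inl d = ax (∨I₁ _ _) · d

inr : Γ ⊢ B → Γ ⊢ (A ∨ B)
inr d = ax (∨I₂ _ _) · d

cases : Γ ⊢ (A ∨ B) → Γ ⊢ (A ⇒ G) → Γ ⊢ (B ⇒ G) → Γ ⊢ G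
cases d l r = ax (∨E _ _ _) · l · r · d

efq : Γ ⊢ ⊥' → Γ ⊢ G
efq d = ax (⊥E _) · d

⇔'-sym : Γ ⊢ (A ⇔' B) → Γ ⊢ (B ⇔' A)
⇔'-sym d = pair (snd d) (fst d)

-- Split on A ∨ (A → G) ∨ ¬G and, in the middle case, on G ∨ (G → A) ∨ ¬A.
N₂-split : Γ ⊢ ¬' (¬' A) → Γ ⊢ ¬' (¬' G) → (Γ ▸ A) ⊢ G → (Γ ▸ (A ⇔' G)) ⊢ G → Γ ⊢ G
N₂-split {Γ} {A} {G} ¬¬A ¬¬G G-if-A G-if-A⇔G =
  cases (ax (N2 A G)) (ƛ G-if-A) (ƛ cases top (wk G-if-A⇒G) (ƛ efq (wk (wk ¬¬G) · top)))
  where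
  G-if-A⇒G : Γ ⊢ ((A ⇒ G) ⇒ G)
  G-if-A⇒G = ƛ cases (ax (N2 G A)) ⊢-id
    (ƛ cases top (ƛ wk (wk (wk (ƛ G-if-A⇔G))) · pair (wk (wk top)) top)
                 (ƛ efq (wk (wk (wk ¬¬A)) · top)))

infixl 5 _⊕_
_⊕_ : (Formula → Set) → List Formula → Formula → Set
Γ ⊕ [] = Γ
Γ ⊕ (A ∷ Ψ) = (Γ ▸ A) ⊕ Ψ

⊕⁺ˡ : ∀ Ψ {F} → Γ F → (Γ ⊕ Ψ) F
⊕⁺ˡ [] g = g
⊕⁺ˡ (A ∷ Ψ) g = ⊕⁺ˡ Ψ (inj₁ g)

⊕⁺ʳ : ∀ {Ψ F} → F ∈ Ψ → (Γ ⊕ Ψ) F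
⊕⁺ʳ {Ψ = A ∷ Ψ} (here refl) = ⊕⁺ˡ Ψ (inj₂ refl)
⊕⁺ʳ {Ψ = A ∷ Ψ} (there F∈Ψ) = ⊕⁺ʳ F∈Ψ

discharge : ∀ Ψ → (∀ {A} → A ∈ Ψ → Γ ⊢ ¬' (¬' A)) → (Γ ⊕ Ψ) ⊢ ⊥' → Γ ⊢ ⊥'
discharge [] _ ⊢⊥ = ⊢⊥
discharge (A ∷ Ψ) ¬¬Ψ ⊢⊥ = ¬¬Ψ (here refl) · (ƛ discharge Ψ (λ A∈Ψ → wk (¬¬Ψ (there A∈Ψ))) ⊢⊥)

-- A case of the split below: the literals of the sublist H ⊆ L are assumed true, those of
-- L ∖ H equivalent to c.
module _ (c : Formula) where
  assumptions : H ⊆ L → List Formula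
  assumptions [] = []
  assumptions (m ∷ʳ s) = (lit m ⇔' c) ∷ assumptions s
  assumptions (_∷_ {y = m} _ s) = lit m ∷ assumptions s

  assumed-𝟙 : (s : H ⊆ L) → l ∈ H → lit l ∈ assumptions s
  assumed-𝟙 (m ∷ʳ s) l∈H = there (assumed-𝟙 s l∈H)
  assumed-𝟙 (refl ∷ s) (here refl) = here refl
  assumed-𝟙 (refl ∷ s) (there l∈H) = there (assumed-𝟙 s l∈H)

  assumed-½ : (s : H ⊆ L) → l ∈ L → l ∉ H → (lit l ⇔' c) ∈ assumptions s
  assumed-½ (m ∷ʳ s) (here refl) _ = here refl
  assumed-½ (m ∷ʳ s) (there l∈L) l∉H = there (assumed-½ s l∈L l∉H)
  assumed-½ (refl ∷ s) (here refl) l∉H = contradiction (here refl) l∉H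
  assumed-½ (refl ∷ s) (there l∈L) l∉H = there (assumed-½ s l∈L (l∉H ∘ there))

  by-cases : ∀ L → (∀ {m} → m ∈ L → Γ ⊢ ¬' (¬' (lit m))) → Γ ⊢ ¬' (¬' c) →
             (∀ {H} (s : H ⊆ L) → (Γ ⊕ assumptions s) ⊢ c) → Γ ⊢ c
  by-cases [] _ _ leaf = leaf []
  by-cases (m ∷ L) ¬¬L ¬¬c leaf = N₂-split (¬¬L (here refl)) ¬¬c
    (by-cases L (λ m∈L → wk (¬¬L (there m∈L))) (wk ¬¬c) (λ s → leaf (refl ∷ s)))
    (by-cases L (λ m∈L → wk (¬¬L (there m∈L))) (wk ¬¬c) (λ s → leaf (m ∷ʳ s)))

-- Kalmár's lemma for three values, ½ being represented by equivalence with c.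
module Kalmár (Γ : Formula → Set) (c : Formula) (¬¬c : Γ ⊢ ¬' (¬' c)) where
  infix 2 ⊢_≐_
  ⊢_≐_ : Formula → HT → Set
  ⊢ G ≐ 𝟘 = Γ ⊢ ¬' G
  ⊢ G ≐ ½ = Γ ⊢ (G ⇔' c)
  ⊢ G ≐ 𝟙 = Γ ⊢ G

  ≐-∧ : ∀ a b → ⊢ A ≐ a → ⊢ B ≐ b → ⊢ A ∧ B ≐ a ⊓ b
  ≐-∧ 𝟘 _ ¬A _ = ƛ wk ¬A · fst top
  ≐-∧ ½ 𝟘 _ ¬B = ƛ wk ¬B · snd top
  ≐-∧ ½ ½ A⇔c B⇔c =
    pair (ƛ wk (fst A⇔c) · fst top) (ƛ pair (wk (snd A⇔c) · top) (wk (snd B⇔c) · top))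
  ≐-∧ ½ 𝟙 A⇔c B = pair (ƛ wk (fst A⇔c) · fst top) (ƛ pair (wk (snd A⇔c) · top) (wk B))
  ≐-∧ 𝟙 𝟘 _ ¬B = ƛ wk ¬B · snd top
  ≐-∧ 𝟙 ½ A B⇔c = pair (ƛ wk (fst B⇔c) · snd top) (ƛ pair (wk A) (wk (snd B⇔c) · top))
  ≐-∧ 𝟙 𝟙 A B = pair A B

  ≐-∨ : ∀ a b → ⊢ A ≐ a → ⊢ B ≐ b → ⊢ A ∨ B ≐ a ⊔ b
  ≐-∨ 𝟘 𝟘 ¬A ¬B = ƛ cases top (wk ¬A) (wk ¬B)
  ≐-∨ 𝟘 ½ ¬A B⇔c =
    pair (ƛ cases top (ƛ efq (wk (wk ¬A) · top)) (wk (fst B⇔c))) (ƛ inr (wk (snd B⇔c) · top))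
  ≐-∨ 𝟘 𝟙 _ B = inr B
  ≐-∨ ½ 𝟘 A⇔c ¬B =
    pair (ƛ cases top (wk (fst A⇔c)) (ƛ efq (wk (wk ¬B) · top))) (ƛ inl (wk (snd A⇔c) · top))
  ≐-∨ ½ ½ A⇔c B⇔c =
    pair (ƛ cases top (wk (fst A⇔c)) (wk (fst B⇔c))) (ƛ inl (wk (snd A⇔c) · top))
  ≐-∨ ½ 𝟙 _ B = inr B
  ≐-∨ 𝟙 _ A _ = inl A

  ≐-⇒ : ∀ a b → ⊢ A ≐ a → ⊢ B ≐ b → ⊢ A ⇒ B ≐ a ⇛ b
  ≐-⇒ 𝟘 _ ¬A _ = ƛ efq (wk ¬A · top)
  ≐-⇒ ½ 𝟘 A⇔c ¬B = ƛ wk ¬¬c · (ƛ wk (wk ¬B) · (wk top · (wk (wk (snd A⇔c)) · top)))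
  ≐-⇒ ½ ½ A⇔c B⇔c = ƛ wk (snd B⇔c) · (wk (fst A⇔c) · top)
  ≐-⇒ ½ 𝟙 _ B = ƛ wk B
  ≐-⇒ 𝟙 𝟘 A ¬B = ƛ wk ¬B · (top · wk A)
  ≐-⇒ 𝟙 ½ A B⇔c = pair (ƛ wk (fst B⇔c) · (top · wk A)) (ƛ ƛ wk (wk (snd B⇔c)) · wk top)
  ≐-⇒ 𝟙 𝟙 _ B = ƛ wk B

  ≐-resp-⇔ : ∀ a → Γ ⊢ (X ⇔' Y) → ⊢ Y ≐ a → ⊢ X ≐ a
  ≐-resp-⇔ 𝟘 X⇔Y ¬Y = ƛ wk ¬Y · (wk (fst X⇔Y) · top)
  ≐-resp-⇔ ½ X⇔Y Y⇔c =
    pair (ƛ wk (fst Y⇔c) · (wk (fst X⇔Y) · top)) (ƛ wk (snd X⇔Y) · (wk (snd Y⇔c) · top))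
  ≐-resp-⇔ 𝟙 X⇔Y Y = snd X⇔Y · Y

  ⊢∼⊥ : Γ ⊢ (∼ ⊥')
  ⊢∼⊥ = snd (fst (ax (N⇒ ⊤' ⊥')) · (snd (ax (N¬ ⊤')) · ⊢-id))

  ≐-refute : ∀ a → ⊢ G ≐ a → Γ ⊢ G → a ≢ 𝟙 → Γ ⊢ c
  ≐-refute 𝟘 ¬G G _ = efq (¬G · G)
  ≐-refute ½ G⇔c G _ = fst G⇔c · G
  ≐-refute 𝟙 _ _ 𝟙≢𝟙 = contradiction refl 𝟙≢𝟙

  module Eval (v : Valuation) (≐-literal : ∀ l → l ∈Lit 𝒜 → ⊢ lit l ≐ v l) where
    mutual
      ≐⟦_⟧ : ∀ G → FormulaOver 𝒜 G → ⊢ G ≐ ⟦ G ⟧ v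
      ≐⟦ var a ⟧ over = ≐-literal (pos a) (over (pos a) (here refl))
      ≐⟦ ⊥' ⟧ _ = ⊢-id
      ≐⟦ A ∧ B ⟧ over =
        ≐-∧ (⟦ A ⟧ v) (⟦ B ⟧ v) (≐⟦ A ⟧ (restrict ∧l over)) (≐⟦ B ⟧ (restrict ∧r over))
      ≐⟦ A ∨ B ⟧ over =
        ≐-∨ (⟦ A ⟧ v) (⟦ B ⟧ v) (≐⟦ A ⟧ (restrict ∨l over)) (≐⟦ B ⟧ (restrict ∨r over))
      ≐⟦ A ⇒ B ⟧ over =
        ≐-⇒ (⟦ A ⟧ v) (⟦ B ⟧ v) (≐⟦ A ⟧ (restrict ⇒l over)) (≐⟦ B ⟧ (restrict ⇒r over))
      ≐⟦ ∼ A ⟧ over = ≐⟦∼ A ⟧ (over-∼ A over)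

      ≐⟦∼_⟧ : ∀ G → FormulaOver 𝒜 G → ⊢ ∼ G ≐ ⟦∼ G ⟧ v
      ≐⟦∼ var a ⟧ over = ≐-literal (neg a) (over (pos a) (here refl))
      ≐⟦∼ ⊥' ⟧ _ = ⊢∼⊥
      ≐⟦∼ A ∧ B ⟧ over = ≐-resp-⇔ (⟦∼ A ∧ B ⟧ v) (ax (N∧ A B))
        (≐-∨ (⟦∼ A ⟧ v) (⟦∼ B ⟧ v) (≐⟦∼ A ⟧ (restrict ∧l over)) (≐⟦∼ B ⟧ (restrict ∧r over)))
      ≐⟦∼ A ∨ B ⟧ over = ≐-resp-⇔ (⟦∼ A ∨ B ⟧ v) (ax (N∨ A B))
        (≐-∧ (⟦∼ A ⟧ v) (⟦∼ B ⟧ v) (≐⟦∼ A ⟧ (restrict ∨l over)) (≐⟦∼ B ⟧ (restrict ∨r over)))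
      ≐⟦∼ A ⇒ B ⟧ over = ≐-resp-⇔ (⟦∼ A ⇒ B ⟧ v) (ax (N⇒ A B))
        (≐-∧ (⟦ A ⟧ v) (⟦∼ B ⟧ v) (≐⟦ A ⟧ (restrict ⇒l over)) (≐⟦∼ B ⟧ (restrict ⇒r over)))
      ≐⟦∼ ∼ A ⟧ over = ≐-resp-⇔ (⟦ A ⟧ v) (⇔'-sym (ax (N∼ A))) (≐⟦ A ⟧ (over-∼ A over))

Minimal : (Formula → Set) → List Lit → Set
Minimal T M = ∀ v → ⌈_⌉ ∘ v ≗ ⟨ M , M ⟩ → v ⊨ T → ∀ {l} → l ∈ M → v l ≡ 𝟙

EquilibriumModel : (Formula → Set) → List Lit → Set
EquilibriumModel T M = ⟨ M , M ⟩ ⊨ T × Minimal T M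

model⇒consistent : ConsistentLits M → ⟨ M , M ⟩ ⊨ T → ¬ (Completion 𝒜 T M ⊢ ⊥')
model⇒consistent cons ⊨T ⊢⊥ with completion-sound ⟨M,M⟩-⌈⌉ cons ⊨T ⊢⊥
... | ()

derivable⇒minimal : ConsistentLits M → (∀ l → l ∈ M → Completion 𝒜 T M ⊢ lit l) → Minimal T M
derivable⇒minimal cons ⊢M v shaped v⊨T {l} l∈M =
  trans (sym (⟦lit⟧ l)) (completion-sound shaped cons v⊨T (⊢M l l∈M))

consistent⇒model : (∀ {R} → T R → FormulaOver 𝒜 R) → ¬ (Completion 𝒜 T M ⊢ ⊥') → ⟨ M , M ⟩ ⊨ T
consistent⇒model {T} {𝒜} {M} T-over ⊬⊥ {R} t =
  value-𝟙 (⟦ R ⟧ ⟨ M , M ⟩) (≐⟦ R ⟧ (T-over t)) (⟨M,M⟩-two-valued R)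
  where
  Γ⁺ : Formula → Set
  Γ⁺ = Completion 𝒜 T M ⊕ map lit M

  ¬¬M : ∀ {A} → A ∈ map lit M → Completion 𝒜 T M ⊢ ¬' (¬' A)
  ¬¬M A∈M with ∈-map⁻ lit A∈M
  ... | m , m∈M , refl = hyp (inM m m∈M)

  ¬¬⊤ : Γ⁺ ⊢ ¬' (¬' ⊤')
  ¬¬⊤ = ƛ top · ⊢-id

  open Kalmár Γ⁺ ⊤' ¬¬⊤

  literal : ∀ l → l ∈Lit 𝒜 → ⊢ lit l ≐ ⟨ M , M ⟩ l
  literal l l∈𝒜 with l ∈? M
  ... | yes l∈M = hyp (⊕⁺ʳ (∈-map⁺ lit l∈M))
  ... | no l∉M = hyp (⊕⁺ˡ (map lit M) (inM̃ l l∈𝒜 l∉M))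

  open Eval ⟨ M , M ⟩ literal

  value-𝟙 : ∀ a → ⊢ R ≐ a → a ≡ ⌈ a ⌉ → a ≡ 𝟙
  value-𝟙 𝟘 ¬R _ =
    contradiction (discharge (map lit M) ¬¬M (¬R · hyp (⊕⁺ˡ (map lit M) (inT t)))) ⊬⊥
  value-𝟙 ½ _ ()
  value-𝟙 𝟙 _ _ = refl

minimal⇒derivable : (∀ {R} → T R ⇔ R ∈ Ts) → (∀ {R} → T R → FormulaOver 𝒜 R) →
                    (∀ {l} → l ∈ M → l ∈Lit 𝒜) → Minimal T M →
                    ∀ {l} → l ∈ M → Completion 𝒜 T M ⊢ lit l
minimal⇒derivable {T} {Ts} {𝒜} {M} listed T-over M⊆𝒜 minimal {l₀} l₀∈M =
  by-cases (lit l₀) M (λ m∈M → hyp (inM _ m∈M)) (hyp (inM l₀ l₀∈M)) leaf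
  where
  leaf : ∀ {H} (s : H ⊆ M) → (Completion 𝒜 T M ⊕ assumptions (lit l₀) s) ⊢ lit l₀
  leaf {H} s = result
    where
    Γ⁺ : Formula → Set
    Γ⁺ = Completion 𝒜 T M ⊕ assumptions (lit l₀) s

    completion : ∀ {F} → Completion 𝒜 T M F → Γ⁺ ⊢ F
    completion F∈ = hyp (⊕⁺ˡ (assumptions (lit l₀) s) F∈)

    open Kalmár Γ⁺ (lit l₀) (completion (inM l₀ l₀∈M))

    literal : ∀ l → l ∈Lit 𝒜 → ⊢ lit l ≐ ⟨ H , M ⟩ l
    literal l l∈𝒜 with l ∈? H | l ∈? M
    ... | yes l∈H | _ = hyp (⊕⁺ʳ (assumed-𝟙 (lit l₀) s l∈H))
    ... | no l∉H | yes l∈M = hyp (⊕⁺ʳ (assumed-½ (lit l₀) s l∈M l∉H))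
    ... | no _ | no l∉M = completion (inM̃ l l∈𝒜 l∉M)

    open Eval ⟨ H , M ⟩ literal

    true? : ∀ R → Dec (⟦ R ⟧ ⟨ H , M ⟩ ≡ 𝟙)
    true? R = ⟦ R ⟧ ⟨ H , M ⟩ ≟ₕ 𝟙

    result : Γ⁺ ⊢ lit l₀
    result with all? true? Ts
    ... | yes all-true = subst (⊢ lit l₀ ≐_) l₀-true (literal l₀ (M⊆𝒜 l₀∈M))
      where
      l₀-true : ⟨ H , M ⟩ l₀ ≡ 𝟙
      l₀-true = minimal ⟨ H , M ⟩ (⟨⟩-⌈⌉ (lookup s)) (All.lookup all-true ∘ to listed) l₀∈M
    ... | no ¬all-true with find (¬All⇒Any¬ true? Ts ¬all-true)
    ...   | R , R∈Ts , R≢𝟙 =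
      ≐-refute (⟦ R ⟧ ⟨ H , M ⟩) (≐⟦ R ⟧ (T-over t)) (completion (inT t)) R≢𝟙
      where
      t : T R
      t = from listed R∈Ts

answerSet⇔equilibrium :
  (∀ {R} → T R ⇔ R ∈ Ts) → (∀ {R} → T R → FormulaOver 𝒜 R) →
  AnswerSet 𝒜 T M ⇔ ((∀ {l} → l ∈ M → l ∈Lit 𝒜) × ConsistentLits M × EquilibriumModel T M)
answerSet⇔equilibrium listed T-over = mk⇔
  (λ (M⊆𝒜 , cons , ⊬⊥ , ⊢M) →
    M⊆𝒜 , cons , consistent⇒model T-over ⊬⊥ , derivable⇒minimal cons ⊢M)
  (λ (M⊆𝒜 , cons , ⊨T , minimal) →
    M⊆𝒜 , cons , model⇒consistent cons ⊨T , λ _ → minimal⇒derivable listed T-over M⊆𝒜 minimal)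

∪｛｝-listed : (P ∪｛ G ｝) R ⇔ (R ∈ G ∷ P)
∪｛｝-listed = mk⇔ (λ { (inj₁ R∈P) → there R∈P ; (inj₂ refl) → here refl })
                   (λ { (here refl) → inj₂ refl ; (there R∈P) → inj₁ R∈P })

module _ {𝓕 : List ℕ} (P : List Formula) (x : Lit) (F : Formula)
         (P-rules : IsProgram P) (x-guarded : ∀ {R} → R ∈ P → ¬ OccursUnguarded x R)
         (F-over : FormulaOver 𝓕 F) (x∉𝓕 : ¬ (x ∈Lit 𝓕)) where

  module _ {v : Valuation} {e : HT} (same-there : ⌈ e ⌉ ≡ ⌈ v x ⌉) where
    P-invariant : R ∈ P → ⟦ R ⟧ (v [ x ≔ e ]) ≡ ⟦ R ⟧ v
    P-invariant R∈P = rule-invariant (λ _ → [≔]-off v e) ([≔]-⌈⌉ v x e same-there)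
                                     (P-rules R∈P) (x-guarded R∈P)

    F-invariant : ⟦ F ⟧ (v [ x ≔ e ]) ≡ ⟦ F ⟧ v
    F-invariant = ⟦⟧-coincide (λ l l∈𝓕 → [≔]-off v e λ { refl → x∉𝓕 l∈𝓕 }) F F-over

  ⊨x⇐F : ⟦ lit x ⇐ F ⟧ v ≡ 𝟙 → ⟦ F ⟧ v ⇛ v x ≡ 𝟙
  ⊨x⇐F {v} = trans (cong (⟦ F ⟧ v ⇛_) (sym (⟦lit⟧ x)))

  ⊨x⇔F : ⟦ lit x ⇔' F ⟧ v ≡ 𝟙 → v x ≡ ⟦ F ⟧ v
  ⊨x⇔F {v} = trans (sym (⟦lit⟧ x)) ∘ 𝟙-⇔ (⟦ lit x ⟧ v) (⟦ F ⟧ v)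

  x⇔F-⊨ : v x ≡ ⟦ F ⟧ v → ⟦ lit x ⇔' F ⟧ v ≡ 𝟙
  x⇔F-⊨ = ⇔-𝟙 ∘ trans (⟦lit⟧ x)

  ⊨x⇔F⇒⊨x⇐F : v ⊨ P ∪｛ lit x ⇔' F ｝ → v ⊨ P ∪｛ lit x ⇐ F ｝
  ⊨x⇔F⇒⊨x⇐F ⊨T (inj₁ R∈P) = ⊨T (inj₁ R∈P)
  ⊨x⇔F⇒⊨x⇐F {v} ⊨T (inj₂ refl) = ⊓-𝟙ʳ (⟦ lit x ⇒ F ⟧ v) _ (⊨T (inj₂ refl))

  equilibrium-⇐⇒⇔ : EquilibriumModel (P ∪｛ lit x ⇐ F ｝) M → EquilibriumModel (P ∪｛ lit x ⇔' F ｝) M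
  equilibrium-⇐⇒⇔ {M} (⊨T⇐ , minimal) = ⊨T⇔ , λ v shaped → minimal v shaped ∘ ⊨x⇔F⇒⊨x⇐F
    where
    F-value : Dec (x ∈ M) → ⟨ M , M ⟩ x ≡ ⟦ F ⟧ ⟨ M , M ⟩
    F-value (no x∉M) = trans x≡𝟘 (sym (⇛𝟙-𝟘 _ (⊨x⇐F (⊨T⇐ (inj₂ refl))) x≡𝟘))
      where
      x≡𝟘 : ⟨ M , M ⟩ x ≡ 𝟘
      x≡𝟘 = ⟨⟩-𝟘 x∉M x∉M
    F-value (yes x∈M) = trans (⟨⟩-𝟙 x∈M) (sym (⌈⌉-fixed _ (⟨M,M⟩-two-valued F) F≢𝟘))
      where
      F≢𝟘 : ⟦ F ⟧ ⟨ M , M ⟩ ≢ 𝟘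
      F≢𝟘 F≡𝟘 = contradiction (minimal v′ v′-shaped v′⊨T⇐ x∈M) v′x≢𝟙
        where
        v′ : Valuation
        v′ = ⟨ M , M ⟩ [ x ≔ ½ ]
        v′x≢𝟙 : v′ x ≢ 𝟙
        v′x≢𝟙 v′x≡𝟙 with trans (sym ([≔]-at ⟨ M , M ⟩ x ½)) v′x≡𝟙
        ... | ()
        same-there : ⌈ ½ ⌉ ≡ ⌈ ⟨ M , M ⟩ x ⌉
        same-there = sym (shaped-∈ ⟨M,M⟩-⌈⌉ x∈M)
        v′-shaped : ⌈_⌉ ∘ v′ ≗ ⟨ M , M ⟩
        v′-shaped l = trans ([≔]-⌈⌉ ⟨ M , M ⟩ x ½ same-there l) (⟨M,M⟩-⌈⌉ l)
        v′⊨T⇐ : v′ ⊨ P ∪｛ lit x ⇐ F ｝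
        v′⊨T⇐ (inj₁ R∈P) = trans (P-invariant same-there R∈P) (⊨T⇐ (inj₁ R∈P))
        v′⊨T⇐ (inj₂ refl) = cong (_⇛ ⟦ lit x ⟧ v′) (trans (F-invariant same-there) F≡𝟘)

    ⊨T⇔ : ⟨ M , M ⟩ ⊨ P ∪｛ lit x ⇔' F ｝
    ⊨T⇔ (inj₁ R∈P) = ⊨T⇐ (inj₁ R∈P)
    ⊨T⇔ (inj₂ refl) = x⇔F-⊨ (F-value (x ∈? M))

  equilibrium-⇔⇒⇐ : EquilibriumModel (P ∪｛ lit x ⇔' F ｝) M → EquilibriumModel (P ∪｛ lit x ⇐ F ｝) M
  equilibrium-⇔⇒⇐ {M} (⊨T⇔ , minimal) = ⊨x⇔F⇒⊨x⇐F ⊨T⇔ , minimal⇐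
    where
    minimal⇐ : Minimal (P ∪｛ lit x ⇐ F ｝) M
    minimal⇐ v shaped ⊨T⇐ = v-total
      where
      same-there : ⌈ ⟦ F ⟧ v ⌉ ≡ ⌈ v x ⌉
      same-there = begin
        ⌈ ⟦ F ⟧ v ⌉       ≡⟨ sym (⟦⟧-⌈⌉ (sym ∘ shaped) F) ⟩
        ⟦ F ⟧ ⟨ M , M ⟩   ≡⟨ sym (⊨x⇔F (⊨T⇔ (inj₂ refl))) ⟩
        ⟨ M , M ⟩ x       ≡⟨ sym (shaped x) ⟩
        ⌈ v x ⌉           ∎

      v⁺ : Valuation
      v⁺ = v [ x ≔ ⟦ F ⟧ v ]

      v⁺-shaped : ⌈_⌉ ∘ v⁺ ≗ ⟨ M , M ⟩
      v⁺-shaped l = trans ([≔]-⌈⌉ v x (⟦ F ⟧ v) same-there l) (shaped l)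

      v⁺⊨T⇔ : v⁺ ⊨ P ∪｛ lit x ⇔' F ｝
      v⁺⊨T⇔ (inj₁ R∈P) = trans (P-invariant same-there R∈P) (⊨T⇐ (inj₁ R∈P))
      v⁺⊨T⇔ (inj₂ refl) = x⇔F-⊨ (trans ([≔]-at v x (⟦ F ⟧ v)) (sym (F-invariant same-there)))

      v⁺-total : ∀ {l} → l ∈ M → v⁺ l ≡ 𝟙
      v⁺-total = minimal v⁺ v⁺-shaped v⁺⊨T⇔

      v-total : ∀ {l} → l ∈ M → v l ≡ 𝟙
      v-total {l} l∈M with l ≟ˡ x
      ... | no l≢x = trans (sym ([≔]-off v (⟦ F ⟧ v) l≢x)) (v⁺-total l∈M)
      ... | yes refl =
        ⇛-mp (⊨x⇐F (⊨T⇐ (inj₂ refl))) (trans (sym ([≔]-at v x (⟦ F ⟧ v))) (v⁺-total l∈M))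

  equilibrium-⇐⇔⇔ : EquilibriumModel (P ∪｛ lit x ⇐ F ｝) M ⇔ EquilibriumModel (P ∪｛ lit x ⇔' F ｝) M
  equilibrium-⇐⇔⇔ = mk⇔ equilibrium-⇐⇒⇔ equilibrium-⇔⇒⇐

theorem2p5 : (𝒜 𝓕 : List ℕ) (P : List Formula) (x : Lit) (F : Formula)
    → ProgramOver 𝒜 P
    → (∀ {R} → R ∈ P → ¬ OccursUnguarded x R)
    → FormulaOver 𝓕 F
    → (∀ l → l ∈Lit 𝓕 → l ∈Lit 𝒜)
    → ¬ (x ∈Lit 𝓕)
    → (M : List Lit)
    → AnswerSet (atomOf x ∷ 𝒜) (P ∪｛ lit x ⇐ F ｝) M
      ⇔ AnswerSet (atomOf x ∷ 𝒜) (P ∪｛ lit x ⇔' F ｝) M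
theorem2p5 𝒜 𝓕 P x F (P-rules , P-over) x-guarded F-over 𝓕⊆𝒜 x∉𝓕 M =
  ⇔.trans (answerSet⇔equilibrium ∪｛｝-listed T⇐-over)
  (⇔.trans (⇔.refl ×-⇔ ⇔.refl ×-⇔ equilibrium-⇐⇔⇔ P x F P-rules x-guarded F-over x∉𝓕)
           (⇔.sym (answerSet⇔equilibrium ∪｛｝-listed T⇔-over)))
  where
  P-overₓ : R ∈ P → FormulaOver (atomOf x ∷ 𝒜) R
  P-overₓ R∈P = over-mono (λ _ → there) (P-over R∈P)

  F-overₓ : FormulaOver (atomOf x ∷ 𝒜) F
  F-overₓ = over-mono (λ l → there ∘ 𝓕⊆𝒜 l) F-over

  T⇐-over : (P ∪｛ lit x ⇐ F ｝) R → FormulaOver (atomOf x ∷ 𝒜) R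
  T⇐-over (inj₁ R∈P) = P-overₓ R∈P
  T⇐-over (inj₂ refl) = over-⇒ F-overₓ over-lit

  T⇔-over : (P ∪｛ lit x ⇔' F ｝) R → FormulaOver (atomOf x ∷ 𝒜) R
  T⇔-over (inj₁ R∈P) = P-overₓ R∈P
  T⇔-over (inj₂ refl) = over-∧ (over-⇒ over-lit F-overₓ) (over-⇒ F-overₓ over-lit)
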